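{- There exist infinitely many natural numbers $n$ which cannot be written as $n = z + x^2$ with $z$ a Zumkeller number and $x$ a positive integer.
   Context: A natural number $n$ is a Zumkeller number if the set of its positive divisors can be partitioned into two subsets with equal sums. Here "a square" means the square of a positive integer. -}

module Defs where

open import Data.Nat using (ℕ; suc; _+_; _≤_; _<_; _^_)
open import Data.Nat.Divisibility using (_∣_; _∣?_)
open import Data.List using (List; filter; applyUpTo; partitionᵇ)
open import Data.Nat.ListAction using (sum)
open import Data.Bool using (Bool)
open import Data.Product using (Σ; ∃; _×_; proj₁; proj₂)
open import Relation.Binary.PropositionalEquality using (_≡_)

divisors : ℕ → List ℕ
divisors n = filter (_∣? n) (applyUpTo suc n)

Zumkeller : ℕ → Set
Zumkeller n = 1 ≤ n × ∃ λ (c : ℕ → Bool) →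
  sum (proj₁ (partitionᵇ c (divisors n))) ≡ sum (proj₂ (partitionᵇ c (divisors n)))

ZumkellerPlusSquare : ℕ → Set
ZumkellerPlusSquare n = ∃ λ z → ∃ λ x → Zumkeller z × 1 ≤ x × n ≡ z + x ^ 2

module Submission where

-- A Zumkeller number z is abundant, σ(z) ≥ 2z, since z lies in one of the two halves of
-- its divisors.  Take N ≡ 2 (mod 4) that is a non-square modulo every odd prime p < K: this
-- is a residue class, built one prime at a time as in the Chinese remainder theorem, since
-- every p ≥ 3 has a non-square residue.  If N = z + x², then z ≢ 0 (mod 4) because
-- x² ≢ 2 (mod 4), so z = m or z = 2m with m odd; and no odd prime p < K divides z, since
-- then N ≡ x² (mod p).  Hence m is a product of at most c primes ≥ K, where N < K^(c+1), so
-- σ(m)/m ≤ (1 + 1/K)^c < 4/3 when 4c < K, and in either case σ(z) < 2z.  The modulus of the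
-- class is at most 4·K^c where c counts the integers below K that are ≤ 7 or coprime to
-- 210, roughly 48K/210 < K/4; so for K = 210(m + 2) the class has a member N ≥ m.

open import Defs
open import Data.Bool using (Bool; true; false; T; if_then_else_; _∨_)
open import Data.Empty using (⊥; ⊥-elim)
open import Data.Fin using (Fin; toℕ; fromℕ<; punchOut)
open import Data.Fin.Properties using (toℕ-fromℕ<; toℕ<n; toℕ-injective; punchOut-injective; injective⇒≤)
open import Data.List using (List; []; _∷_; _++_; map; length; applyUpTo; partitionᵇ)
open import Data.List.Membership.Propositional using (_∈_)
open import Data.List.Membership.Propositional.Properties
  using (∈-filter⁺; ∈-filter⁻; ∈-applyUpTo⁺; ∈-applyUpTo⁻; ∈-∃++; ∈-++⁺ˡ; ∈-++⁺ʳ; ∈-map⁺)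
open import Data.List.Relation.Binary.Subset.Propositional using (_⊆_)
open import Data.List.Relation.Unary.All as All using (All; []; _∷_)
open import Data.List.Relation.Unary.AllPairs using (_∷_)
open import Data.List.Relation.Unary.Any using (here; there)
open import Data.List.Relation.Unary.Unique.Propositional using (Unique)
import Data.List.Relation.Unary.Unique.Propositional.Properties as Unique
open import Data.Nat
open import Data.Nat.Coprimality using (Coprime; gcd≡1⇒coprime; coprime-divisor)
open import Data.Nat.Divisibility
open import Data.Nat.DivMod
open import Data.Nat.GCD using (gcd[m,n]∣m; gcd[m,n]∣n)
open import Data.Nat.ListAction using (sum; product)
open import Data.Nat.ListAction.Properties using (sum-++; ∈⇒∣product)
open import Data.Nat.Primality
open import Data.Nat.Primality.Factorisation using (PrimeFactorisation; factorise)
open import Data.Nat.Properties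
open import Algebra.Properties.CommutativeSemigroup +-commutativeSemigroup using (x∙yz≈y∙xz)
open import Data.Nat.Tactic.RingSolver using (solve-∀)
open import Data.Product using (∃; _×_; _,_; proj₁; proj₂)
open import Data.Sum using (_⊎_; inj₁; inj₂; [_,_]′; map₂)
open import Function using (_∘_; _∘₂_)
open import Function.Definitions using (Injective)
open import Relation.Binary.PropositionalEquality
open import Relation.Nullary using (¬_; yes; no; ¬?; contradiction)
open import Relation.Nullary.Decidable using (decidable-stable)

-- Divisor sums

σ : ℕ → ℕ
σ n = sum (divisors n)

module _ (c : ℕ → Bool) where

  sum-partitionᵇ : ∀ xs → sum (proj₁ (partitionᵇ c xs)) + sum (proj₂ (partitionᵇ c xs)) ≡ sum xs
  sum-partitionᵇ [] = refl
  sum-partitionᵇ (x ∷ xs) with c x | partitionᵇ c xs | sum-partitionᵇ xs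
  ... | true  | ys , zs | ih = trans (+-assoc x (sum ys) (sum zs)) (cong (x +_) ih)
  ... | false | ys , zs | ih = begin
    sum ys + (x + sum zs) ≡⟨ x∙yz≈y∙xz (sum ys) x (sum zs) ⟩
    x + (sum ys + sum zs) ≡⟨ cong (x +_) ih ⟩
    x + sum xs            ∎
    where open ≡-Reasoning

  ∈⇒≤-sum-partitionᵇ : ∀ {x xs} → x ∈ xs →
                       x ≤ sum (proj₁ (partitionᵇ c xs)) ⊎ x ≤ sum (proj₂ (partitionᵇ c xs))
  ∈⇒≤-sum-partitionᵇ {_} {x ∷ xs} (here refl) with c x | partitionᵇ c xs
  ... | true  | _ = inj₁ (m≤m+n x _)
  ... | false | _ = inj₂ (m≤m+n x _)
  ∈⇒≤-sum-partitionᵇ {_} {x ∷ xs} (there y∈xs) with c x | partitionᵇ c xs | ∈⇒≤-sum-partitionᵇ y∈xs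
  ... | true  | _ | inj₁ y≤ = inj₁ (m≤n⇒m≤o+n x y≤)
  ... | true  | _ | inj₂ y≤ = inj₂ y≤
  ... | false | _ | inj₁ y≤ = inj₁ y≤
  ... | false | _ | inj₂ y≤ = inj₂ (m≤n⇒m≤o+n x y≤)

∈-divisors⁺ : ∀ {d n} → 1 ≤ d → d ≤ n → d ∣ n → d ∈ divisors n
∈-divisors⁺ {suc _} {n} _ d≤n d∣n = ∈-filter⁺ (_∣? n) (∈-applyUpTo⁺ suc d≤n) d∣n

∈-divisors⁻ : ∀ {d n} → d ∈ divisors n → 1 ≤ d × d ∣ n
∈-divisors⁻ {d} {n} d∈ with ∈-filter⁻ (_∣? n) {xs = applyUpTo suc n} d∈
... | d∈range , d∣n with ∈-applyUpTo⁻ suc d∈range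
...   | _ , _ , refl = s≤s z≤n , d∣n

divisors-unique : ∀ n → Unique (divisors n)
divisors-unique n =
  Unique.filter⁺ (_∣? n) (Unique.applyUpTo⁺₁ suc n (λ i<j _ → <⇒≢ i<j ∘ suc-injective))

zumkeller⇒abundant : ∀ {z} → Zumkeller z → 2 * z ≤ σ z
zumkeller⇒abundant {z@(suc _)} (_ , c , balanced) =
  subst (2 * z ≤_) (sum-partitionᵇ c (divisors z))
    (twice-≤ balanced (∈⇒≤-sum-partitionᵇ c (∈-divisors⁺ (s≤s z≤n) ≤-refl ∣-refl)))
  where
  twice-≤ : ∀ {a b} → a ≡ b → z ≤ a ⊎ z ≤ b → 2 * z ≤ a + b
  twice-≤ refl (inj₁ z≤a) = +-mono-≤ z≤a (≤-trans (≤-reflexive (+-identityʳ z)) z≤a)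
  twice-≤ refl (inj₂ z≤a) = +-mono-≤ z≤a (≤-trans (≤-reflexive (+-identityʳ z)) z≤a)

sum-map-* : ∀ k (xs : List ℕ) → sum (map (k *_) xs) ≡ k * sum xs
sum-map-* k []       = sym (*-zeroʳ k)
sum-map-* k (x ∷ xs) = trans (cong (k * x +_) (sum-map-* k xs)) (sym (*-distribˡ-+ k x (sum xs)))

sum-++-∷ : ∀ x (as bs : List ℕ) → sum (as ++ x ∷ bs) ≡ x + sum (as ++ bs)
sum-++-∷ x as bs = begin
  sum (as ++ x ∷ bs)    ≡⟨ sum-++ as (x ∷ bs) ⟩
  sum as + (x + sum bs) ≡⟨ x∙yz≈y∙xz (sum as) x (sum bs) ⟩
  x + (sum as + sum bs) ≡⟨ cong (x +_) (sym (sum-++ as bs)) ⟩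
  x + sum (as ++ bs)    ∎
  where open ≡-Reasoning

∈-++-∷⁻ : ∀ {x y : ℕ} as bs → y ∈ as ++ x ∷ bs → y ≢ x → y ∈ as ++ bs
∈-++-∷⁻ []       bs (here refl) y≢x = contradiction refl y≢x
∈-++-∷⁻ []       bs (there y∈)  _   = y∈
∈-++-∷⁻ (a ∷ as) bs (here refl) _   = here refl
∈-++-∷⁻ (a ∷ as) bs (there y∈)  y≢x = there (∈-++-∷⁻ as bs y∈ y≢x)

sum-mono-⊆ : ∀ {xs ys : List ℕ} → Unique xs → xs ⊆ ys → sum xs ≤ sum ys
sum-mono-⊆ {[]}     _              _     = z≤n
sum-mono-⊆ {x ∷ xs} (x∉xs ∷ uniq) xs⊆ys with ∈-∃++ (xs⊆ys (here refl))
... | as , bs , refl = subst (x + sum xs ≤_) (sym (sum-++-∷ x as bs))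
  (+-monoʳ-≤ x (sum-mono-⊆ uniq λ y∈xs →
    ∈-++-∷⁻ as bs (xs⊆ys (there y∈xs)) (λ y≡x → All.lookup x∉xs y∈xs (sym y≡x))))

prime∤⇒coprime : ∀ {p d} → Prime p → ¬ p ∣ d → Coprime d p
prime∤⇒coprime {p} {d} pp p∤d with prime⇒irreducible pp (gcd[m,n]∣n d p)
... | inj₁ gcd≡1 = gcd≡1⇒coprime gcd≡1
... | inj₂ gcd≡p = contradiction (subst (_∣ d) gcd≡p (gcd[m,n]∣m d p)) p∤d

σ[p*n]≤[1+p]*σ[n] : ∀ {p n} → Prime p → .{{NonZero n}} → σ (p * n) ≤ (1 + p) * σ n
σ[p*n]≤[1+p]*σ[n] {p} {n} pp =
  subst (σ (p * n) ≤_) (trans (sum-++ (divisors n) _) (cong (σ n +_) (sum-map-* p (divisors n))))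
    (sum-mono-⊆ (divisors-unique (p * n)) divisor-split)
  where
  instance _ = prime⇒nonZero pp
  divisor-split : divisors (p * n) ⊆ divisors n ++ map (p *_) (divisors n)
  divisor-split {d} d∈ with ∈-divisors⁻ {d} {p * n} d∈
  ... | 1≤d , d∣pn with p ∣? d
  ... | no p∤d = ∈-++⁺ˡ (∈-divisors⁺ 1≤d (∣⇒≤ d∣n) d∣n)
    where d∣n = coprime-divisor (prime∤⇒coprime pp p∤d) d∣pn
  ... | yes (divides e refl) =
    ∈-++⁺ʳ (divisors n) (subst (_∈ map (p *_) (divisors n)) (*-comm p e) (∈-map⁺ (p *_) e∈))
    where
    e∣n : e ∣ n
    e∣n = *-cancelˡ-∣ p (subst (_∣ p * n) (*-comm e p) d∣pn)
    e∈ : e ∈ divisors n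
    e∈ = ∈-divisors⁺ (>-nonZero⁻¹ e {{m*n≢0⇒m≢0 e {{>-nonZero 1≤d}}}}) (∣⇒≤ e∣n) e∣n

^length≤product : ∀ {K} ns → All (K ≤_) ns → K ^ length ns ≤ product ns
^length≤product []       []            = ≤-refl
^length≤product (n ∷ ns) (K≤n ∷ K≤ns) = *-mono-≤ K≤n (^length≤product ns K≤ns)

σ-product-bound : ∀ K ps → All Prime ps → All (K ≤_) ps →
                  σ (product ps) * K ^ length ps ≤ (1 + K) ^ length ps * product ps
σ-product-bound K []       []         []            = ≤-refl
σ-product-bound K (p ∷ ps) (pp ∷ pps) (K≤p ∷ K≤ps) = begin
  σ (p * n) * (K * K ^ j)           ≤⟨ *-monoˡ-≤ (K * K ^ j) (σ[p*n]≤[1+p]*σ[n] pp) ⟩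
  (1 + p) * σ n * (K * K ^ j)       ≡⟨ [m*n]*[o*p]≡[m*o]*[n*p] (1 + p) (σ n) K (K ^ j) ⟩
  (1 + p) * K * (σ n * K ^ j)       ≤⟨ *-mono-≤ [1+p]K≤p[1+K] (σ-product-bound K ps pps K≤ps) ⟩
  p * (1 + K) * ((1 + K) ^ j * n)   ≡⟨ cong (_* ((1 + K) ^ j * n)) (*-comm p (1 + K)) ⟩
  (1 + K) * p * ((1 + K) ^ j * n)   ≡⟨ [m*n]*[o*p]≡[m*o]*[n*p] (1 + K) p ((1 + K) ^ j) n ⟩
  (1 + K) * (1 + K) ^ j * (p * n)   ∎
  where
  open ≤-Reasoning
  n = product ps
  j = length ps
  instance _ = productOfPrimes≢0 pps
  [1+p]K≤p[1+K] : (1 + p) * K ≤ p * (1 + K)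
  [1+p]K≤p[1+K] = subst ((1 + p) * K ≤_) (sym (*-suc p K)) (+-monoˡ-≤ (p * K) K≤p)

[1+K]^j-bound : ∀ K j → (1 + K) ^ j * (1 + K) ≤ K ^ j * (1 + K) + j * (1 + K) ^ j
[1+K]^j-bound K zero    = ≤-reflexive (sym (+-identityʳ _))
[1+K]^j-bound K (suc j) = begin
  (1 + K) * A * (1 + K)                          ≡⟨ *-assoc (1 + K) A (1 + K) ⟩
  (1 + K) * (A * (1 + K))                        ≤⟨ *-monoʳ-≤ (1 + K) ([1+K]^j-bound K j) ⟩
  (1 + K) * (B * (1 + K) + j * A)                ≡⟨ expand K A B j ⟩
  K * B * (1 + K) + B * (1 + K) + j * ((1 + K) * A)
    ≤⟨ +-monoˡ-≤ _ (+-monoʳ-≤ (K * B * (1 + K)) B[1+K]≤[1+K]A) ⟩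
  K * B * (1 + K) + (1 + K) * A + j * ((1 + K) * A) ≡⟨ +-assoc (K * B * (1 + K)) _ _ ⟩
  K * B * (1 + K) + suc j * ((1 + K) * A)        ∎
  where
  open ≤-Reasoning
  A = (1 + K) ^ j
  B = K ^ j
  expand : ∀ K A B j → (1 + K) * (B * (1 + K) + j * A) ≡
                       K * B * (1 + K) + B * (1 + K) + j * ((1 + K) * A)
  expand = solve-∀
  B[1+K]≤[1+K]A : B * (1 + K) ≤ (1 + K) * A
  B[1+K]≤[1+K]A = subst (B * (1 + K) ≤_) (*-comm A (1 + K)) (*-monoˡ-≤ (1 + K) (^-monoˡ-≤ j (n≤1+n K)))

3*[1+K]^j<4*K^j : ∀ K j → 4 * j < 1 + K → 3 * (1 + K) ^ j < 4 * K ^ j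
3*[1+K]^j<4*K^j K j 4j<1+K =
  *-cancelʳ-< (1 + K) (3 * A) (4 * B) (+-cancelʳ-< (A * (1 + K)) _ _ (begin-strict
  3 * A * (1 + K) + A * (1 + K)    ≡⟨ e₁ A (1 + K) ⟩
  4 * (A * (1 + K))                ≤⟨ *-monoʳ-≤ 4 ([1+K]^j-bound K j) ⟩
  4 * (B * (1 + K) + j * A)        ≡⟨ e₂ A B (1 + K) j ⟩
  4 * B * (1 + K) + 4 * j * A      <⟨ +-monoʳ-< (4 * B * (1 + K)) (*-monoˡ-< A 4j<1+K) ⟩
  4 * B * (1 + K) + (1 + K) * A    ≡⟨ cong (4 * B * (1 + K) +_) (*-comm (1 + K) A) ⟩
  4 * B * (1 + K) + A * (1 + K)    ∎))
  where
  open ≤-Reasoning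
  A = (1 + K) ^ j
  B = K ^ j
  instance _ = >-nonZero (m^n>0 (1 + K) j)
  e₁ : ∀ A M → 3 * A * M + A * M ≡ 4 * (A * M)
  e₁ = solve-∀
  e₂ : ∀ A B M j → 4 * (B * M + j * A) ≡ 4 * B * M + 4 * j * A
  e₂ = solve-∀

σ-product-of-large-primes : ∀ K ps → All Prime ps → All (K ≤_) ps → 4 * length ps < 1 + K →
                            3 * σ (product ps) < 4 * product ps
σ-product-of-large-primes K ps pps K≤ps 4j<1+K = *-cancelʳ-< (K ^ j) (3 * σ n) (4 * n) (begin-strict
  3 * σ n * K ^ j         ≡⟨ *-assoc 3 (σ n) (K ^ j) ⟩
  3 * (σ n * K ^ j)       ≤⟨ *-monoʳ-≤ 3 (σ-product-bound K ps pps K≤ps) ⟩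
  3 * ((1 + K) ^ j * n)   ≡⟨ *-assoc 3 ((1 + K) ^ j) n ⟨
  3 * (1 + K) ^ j * n     <⟨ *-monoˡ-< n (3*[1+K]^j<4*K^j K j 4j<1+K) ⟩
  4 * K ^ j * n           ≡⟨ *-assoc 4 (K ^ j) n ⟩
  4 * (K ^ j * n)         ≡⟨ cong (4 *_) (*-comm (K ^ j) n) ⟩
  4 * (n * K ^ j)         ≡⟨ *-assoc 4 n (K ^ j) ⟨
  4 * n * K ^ j           ∎)
  where
  open ≤-Reasoning
  n = product ps
  j = length ps
  instance _ = productOfPrimes≢0 pps

-- Counting prime candidates

sumBelow : ℕ → (ℕ → ℕ) → ℕ
sumBelow zero    f = 0
sumBelow (suc n) f = sumBelow n f + f n

sumBelow-+ : ∀ m n f → sumBelow (m + n) f ≡ sumBelow m f + sumBelow n (f ∘ (m +_))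
sumBelow-+ m zero    f = trans (cong (λ k → sumBelow k f) (+-identityʳ m)) (sym (+-identityʳ _))
sumBelow-+ m (suc n) f = begin
  sumBelow (m + suc n) f                             ≡⟨ cong (λ k → sumBelow k f) (+-suc m n) ⟩
  sumBelow (m + n) f + f (m + n)                     ≡⟨ cong (_+ f (m + n)) (sumBelow-+ m n f) ⟩
  sumBelow m f + sumBelow n (f ∘ (m +_)) + f (m + n) ≡⟨ +-assoc (sumBelow m f) _ _ ⟩
  sumBelow m f + sumBelow (suc n) (f ∘ (m +_))       ∎
  where open ≡-Reasoning

sumBelow-cong : ∀ n {f g} → (∀ i → f i ≡ g i) → sumBelow n f ≡ sumBelow n g
sumBelow-cong zero    f≗g = refl
sumBelow-cong (suc n) f≗g = cong₂ _+_ (sumBelow-cong n f≗g) (f≗g n)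

hasPrimeFactor≤7ᵇ : ℕ → Bool
hasPrimeFactor≤7ᵇ k = (k % 2 ≡ᵇ 0) ∨ (k % 3 ≡ᵇ 0) ∨ (k % 5 ≡ᵇ 0) ∨ (k % 7 ≡ᵇ 0)

wheel : ℕ → ℕ
wheel k = if hasPrimeFactor≤7ᵇ k then 0 else 1

-- Majorises the indicator of the primes, with density 48/210 < 1/4 (candidatesBelow-210).
primeCandidate : ℕ → ℕ
primeCandidate k = if k ≤ᵇ 7 then 1 else wheel k

primeCandidate-prime : ∀ {k} → Prime k → primeCandidate k ≡ 1
primeCandidate-prime {k} pk with k ≤ᵇ 7 in k≤ᵇ7
... | true  = refl
... | false = cong (λ b → if b then 0 else 1)
  (cong₂ _∨_ (no-factor 2 _) (cong₂ _∨_ (no-factor 3 _) (cong₂ _∨_ (no-factor 5 _) (no-factor 7 _))))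
  where
  no-factor : ∀ p .{{_ : NonZero p}} .{{_ : NonTrivial p}} → T (p ≤ᵇ 7) → (k % p ≡ᵇ 0) ≡ false
  no-factor p p≤7 with k % p ≡ᵇ 0 in k%p≡ᵇ0
  ... | false = refl
  ... | true  = contradiction (composite p<k p∣k) (Prime.notComposite pk)
    where
    p<k = ≤-<-trans (≤ᵇ⇒≤ p 7 p≤7) (≰⇒> (λ k≤7 → subst T k≤ᵇ7 (≤⇒≤ᵇ k≤7)))
    p∣k = m%n≡0⇒n∣m k p (≡ᵇ⇒≡ (k % p) 0 (subst T (sym k%p≡ᵇ0) _))

primeCandidate-periodic : ∀ s r → primeCandidate (210 * suc s + r) ≡ wheel r
primeCandidate-periodic s r with 210 * suc s + r ≤ᵇ 7 in ≤7
... | true  = contradiction (≤ᵇ⇒≤ _ 7 (subst T (sym ≤7) _)) (<⇒≱ 7<)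
  where 7< = ≤-trans (≤ᵇ⇒≤ 8 210 _) (≤-trans (m≤m*n 210 (suc s)) (m≤m+n _ r))
... | false = cong (λ b → if b then 0 else 1)
  (cong₂ _∨_ (same 2 (divides 105 refl)) (cong₂ _∨_ (same 3 (divides 70 refl))
    (cong₂ _∨_ (same 5 (divides 42 refl)) (same 7 (divides 30 refl)))))
  where
  same : ∀ p .{{_ : NonZero p}} → p ∣ 210 → ((210 * suc s + r) % p ≡ᵇ 0) ≡ (r % p ≡ᵇ 0)
  same p p∣210 = cong (_≡ᵇ 0) (%-remove-+ˡ r (∣-trans p∣210 (m∣m*n (suc s))))

candidatesBelow : ℕ → ℕ
candidatesBelow k = sumBelow k primeCandidate

candidatesBelow-210 : ∀ t → candidatesBelow (210 * suc t) ≡ 55 + 48 * t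
candidatesBelow-210 zero    = refl
candidatesBelow-210 (suc t) = begin
  candidatesBelow (210 * suc (suc t))                  ≡⟨ cong candidatesBelow next-period ⟩
  candidatesBelow (210 * suc t + 210)                  ≡⟨ sumBelow-+ (210 * suc t) 210 primeCandidate ⟩
  candidatesBelow (210 * suc t) + sumBelow 210 (primeCandidate ∘ (210 * suc t +_))
    ≡⟨ cong₂ _+_ (candidatesBelow-210 t) (sumBelow-cong 210 (primeCandidate-periodic t)) ⟩
  55 + 48 * t + sumBelow 210 wheel                     ≡⟨ +-assoc 55 (48 * t) 48 ⟩
  55 + (48 * t + 48)                                   ≡⟨ cong (55 +_) (+-comm (48 * t) 48) ⟩
  55 + (48 + 48 * t)                                   ≡⟨ cong (55 +_) (*-suc 48 t) ⟨
  55 + 48 * suc t                                      ∎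
  where
  open ≡-Reasoning
  next-period : 210 * suc (suc t) ≡ 210 * suc t + 210
  next-period = trans (*-suc 210 (suc t)) (+-comm 210 _)

-- Non-squares and linear congruences

injective⇒surjective< : ∀ {p} (f : ℕ → ℕ) → (∀ {x} → x < p → f x < p) →
                        (∀ {x y} → x < p → y < p → f x ≡ f y → x ≡ y) →
                        ∀ {r} → r < p → ∃ λ x → x < p × f x ≡ r
injective⇒surjective< {suc p} f f< f-inj {r} r<p with anyUpTo? (λ x → f x ≟ r) (suc p)
... | yes hit  = hit
... | no  miss = contradiction (injective⇒≤ g-injective) 1+n≰n
  where
  image : Fin (suc p) → Fin (suc p)
  image i = fromℕ< (f< (toℕ<n i))
  toℕ-image : ∀ i → toℕ (image i) ≡ f (toℕ i)
  toℕ-image i = toℕ-fromℕ< (f< (toℕ<n i))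
  r∉image : ∀ i → fromℕ< r<p ≢ image i
  r∉image i r≡fi = miss (toℕ i , toℕ<n i ,
    trans (sym (toℕ-image i)) (trans (cong toℕ (sym r≡fi)) (toℕ-fromℕ< r<p)))
  g : Fin (suc p) → Fin p
  g i = punchOut (r∉image i)
  g-injective : Injective _≡_ _≡_ g
  g-injective {i} {j} gi≡gj = toℕ-injective (f-inj (toℕ<n i) (toℕ<n j)
    (trans (sym (toℕ-image i))
      (trans (cong toℕ (punchOut-injective (r∉image i) (r∉image j) gi≡gj)) (toℕ-image j))))

NonSquareMod : (p : ℕ) .{{_ : NonZero p}} → ℕ → Set
NonSquareMod p n = ∀ x → (x * x) % p ≢ n % p

module _ (k : ℕ) where
  private
    p = 3 + k
    sq : ℕ → ℕ
    sq x = (x * x) % p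
    sq[p-1]≡1 : sq (2 + k) ≡ 1
    sq[p-1]≡1 = trans (cong (_% p) (expand k)) ([m+kn]%n≡m%n 1 (1 + k) p)
      where
      expand : ∀ k → (2 + k) * (2 + k) ≡ 1 + (1 + k) * (3 + k)
      expand = solve-∀

  -- If every residue had a square root, choosing one would inject the residues into
  -- themselves, hence biject; but 1 and p - 1 have the same square.
  ∃-nonSquareMod : ∃ (NonSquareMod p)
  ∃-nonSquareMod with anyUpTo? (λ r → ¬? (anyUpTo? (λ x → sq x ≟ r) p)) p
  ... | yes (r , r<p , r-nonSquare) = r , λ x x²≡r →
    r-nonSquare (x % p , m%n<n x p , trans (sym (%-distribˡ-* x x p)) (trans x²≡r (m<n⇒m%n≡m r<p)))
  ... | no all-square =
    let a , a<p , root[a]≡1   = onto (s≤s (s≤s z≤n))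
        b , b<p , root[b]≡p-1 = onto ≤-refl
        a≡b = trans (sym (sq-root a<p)) (trans (cong sq root[a]≡1)
                (sym (trans (sym (sq-root b<p)) (trans (cong sq root[b]≡p-1) sq[p-1]≡1))))
    in contradiction (trans (sym root[a]≡1) (trans (cong root a≡b) root[b]≡p-1)) (λ ())
    where
    root< : ∀ {r} → r < p → ∃ λ x → x < p × sq x ≡ r
    root< {r} r<p =
      decidable-stable (anyUpTo? (λ x → sq x ≟ r) p) (λ no-root → all-square (r , r<p , no-root))
    root : ℕ → ℕ
    root r = proj₁ (root< (m%n<n r p))
    sq-root : ∀ {r} → r < p → sq (root r) ≡ r
    sq-root {r} r<p = trans (proj₂ (proj₂ (root< (m%n<n r p)))) (m<n⇒m%n≡m r<p)
    root-injective : ∀ {x y} → x < p → y < p → root x ≡ root y → x ≡ y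
    root-injective x<p y<p rx≡ry = trans (sym (sq-root x<p)) (trans (cong sq rx≡ry) (sq-root y<p))
    onto : ∀ {r} → r < p → ∃ λ x → x < p × root x ≡ r
    onto = injective⇒surjective< root (λ {x} _ → proj₁ (proj₂ (root< (m%n<n x p)))) root-injective

[m+n]%d≡m%d⇒d∣n : ∀ m n d .{{_ : NonZero d}} → (m + n) % d ≡ m % d → d ∣ n
[m+n]%d≡m%d⇒d∣n m n d eq = ∣m+n∣m⇒∣n (divides ((m + n) / d) (sym quotients)) (divides (m / d) refl)
  where
  open ≡-Reasoning
  quotients : (m + n) / d * d ≡ m / d * d + n
  quotients = +-cancelˡ-≡ (m % d) _ _ (begin
    m % d + (m + n) / d * d       ≡⟨ cong (_+ (m + n) / d * d) eq ⟨
    (m + n) % d + (m + n) / d * d ≡⟨ m≡m%n+[m/n]*n (m + n) d ⟨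
    m + n                         ≡⟨ cong (_+ n) (m≡m%n+[m/n]*n m d) ⟩
    m % d + m / d * d + n         ≡⟨ +-assoc (m % d) _ n ⟩
    m % d + (m / d * d + n)       ∎)

module _ {p L} .{{_ : NonZero p}} (pp : Prime p) (p∤L : ¬ p ∣ L) (n : ℕ) where

  private
    shift-injective≤ : ∀ {x y} → x ≤ y → y < p → (n + L * y) % p ≡ (n + L * x) % p → x ≡ y
    shift-injective≤ {x} x≤y y<p eq with m≤n⇒∃[o]m+o≡n x≤y
    ... | d , refl with euclidsLemma L d pp ([m+n]%d≡m%d⇒d∣n (n + L * x) (L * d) p
                          (trans (cong (_% p) (sym (split n L x d))) eq))
      where
      split : ∀ n L x d → n + L * (x + d) ≡ n + L * x + L * d
      split = solve-∀
    ... | inj₁ p∣L = contradiction p∣L p∤L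
    ... | inj₂ p∣d with d
    ...   | zero  = sym (+-identityʳ x)
    ...   | suc _ = contradiction (∣⇒≤ p∣d) (<⇒≱ (≤-<-trans (m≤n+m _ x) y<p))

  solve-n+L*t≡r : ∀ r → ∃ λ t → t < p × (n + L * t) % p ≡ r % p
  solve-n+L*t≡r r = injective⇒surjective< (λ t → (n + L * t) % p) (λ _ → m%n<n _ p) shift-injective (m%n<n r p)
    where
    shift-injective : ∀ {x y} → x < p → y < p → (n + L * x) % p ≡ (n + L * y) % p → x ≡ y
    shift-injective {x} {y} x<p y<p eq with ≤-total x y
    ... | inj₁ x≤y = shift-injective≤ x≤y y<p (sym eq)
    ... | inj₂ y≤x = sym (shift-injective≤ y≤x x<p eq)

NonSquareMod-cong : ∀ {p} .{{_ : NonZero p}} {n n′} → n % p ≡ n′ % p → NonSquareMod p n → NonSquareMod p n′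
NonSquareMod-cong n≡n′ nonSquare x x²≡n′ = nonSquare x (trans x²≡n′ (sym n≡n′))

-- Residue classes of non-squares

prime∣2⇒≡2 : ∀ {p} → Prime p → p ∣ 2 → p ≡ 2
prime∣2⇒≡2 pp p∣2 with prime⇒irreducible prime[2] p∣2
... | inj₁ refl = contradiction pp ¬prime[1]
... | inj₂ p≡2  = p≡2

prime∣4⇒≡2 : ∀ {p} → Prime p → p ∣ 4 → p ≡ 2
prime∣4⇒≡2 pp p∣4 = [ prime∣2⇒≡2 pp , prime∣2⇒≡2 pp ]′ (euclidsLemma 2 2 pp p∣4)

record NonSquareClass (k : ℕ) : Set where
  field
    n L           : ℕ
    n%4≡2         : n % 4 ≡ 2
    4∣L           : 4 ∣ L
    n<L           : n < L
    prime∣L       : ∀ {p} → Prime p → p ∣ L → p ≡ 2 ⊎ p < k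
    oddPrime∣L    : ∀ {p} → Prime p → p ≢ 2 → p < k → p ∣ L
    nonSquare     : ∀ {p} .{{_ : NonZero p}} → Prime p → p ≢ 2 → p < k → NonSquareMod p n
    L≤4*k^cands   : L ≤ 4 * k ^ candidatesBelow k

module _ {k} (C : NonSquareClass k) where
  open NonSquareClass C

  member%4≡2 : ∀ t → (n + L * t) % 4 ≡ 2
  member%4≡2 t = trans (%-remove-+ʳ n (∣-trans 4∣L (m∣m*n t))) n%4≡2

  member-nonSquare : ∀ t {p} .{{_ : NonZero p}} → Prime p → p ≢ 2 → p < k → NonSquareMod p (n + L * t)
  member-nonSquare t pp p≢2 p<k =
    NonSquareMod-cong (sym (%-remove-+ʳ n (∣-trans (oddPrime∣L pp p≢2 p<k) (m∣m*n t)))) (nonSquare pp p≢2 p<k)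

nonSquareClass₀ : NonSquareClass 0
nonSquareClass₀ = record
  { n = 2 ; L = 4 ; n%4≡2 = refl ; 4∣L = ∣-refl ; n<L = ≤ᵇ⇒≤ 3 4 _
  ; prime∣L = inj₁ ∘₂ prime∣4⇒≡2 ; oddPrime∣L = λ _ _ () ; nonSquare = λ _ _ () ; L≤4*k^cands = ≤-refl }

skip-nonOddPrime : ∀ {k} → (Prime k → k ≢ 2 → ⊥) → NonSquareClass k → NonSquareClass (suc k)
skip-nonOddPrime {k} not-odd-prime C = record
  { NonSquareClass C
  ; prime∣L     = map₂ m<n⇒m<1+n ∘₂ prime∣L
  ; oddPrime∣L  = λ pp p≢2 → oddPrime∣L pp p≢2 ∘ below-k pp p≢2
  ; nonSquare   = λ pp p≢2 → nonSquare pp p≢2 ∘ below-k pp p≢2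
  ; L≤4*k^cands = ≤-trans L≤4*k^cands (*-monoʳ-≤ 4 (≤-trans (^-monoˡ-≤ (candidatesBelow k) (n≤1+n k))
                    (^-monoʳ-≤ (suc k) (m≤m+n (candidatesBelow k) (primeCandidate k)))))
  }
  where
  open NonSquareClass C
  below-k : ∀ {p} → Prime p → p ≢ 2 → p < suc k → p < k
  below-k pp p≢2 p<1+k with m<1+n⇒m<n∨m≡n p<1+k
  ... | inj₁ p<k  = p<k
  ... | inj₂ refl = ⊥-elim (not-odd-prime pp p≢2)

extend-oddPrime : ∀ j → Prime (3 + j) → NonSquareClass (3 + j) → NonSquareClass (4 + j)
extend-oddPrime j pk C = record
  { n             = n + L * t
  ; L             = L * k
  ; n%4≡2         = member%4≡2 C t
  ; 4∣L           = ∣-trans 4∣L (m∣m*n k)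
  ; n<L           = begin-strict
      n + L * t   <⟨ +-monoˡ-< (L * t) n<L ⟩
      L + L * t   ≡⟨ *-suc L t ⟨
      L * suc t   ≤⟨ *-monoʳ-≤ L t<k ⟩
      L * k       ∎
  ; prime∣L       = prime∣L′
  ; oddPrime∣L    = oddPrime∣L′
  ; nonSquare     = nonSquare′
  ; L≤4*k^cands   = begin
      L * k                                ≤⟨ *-mono-≤ L≤4*k^cands (n≤1+n k) ⟩
      4 * k ^ c * suc k                    ≤⟨ *-monoˡ-≤ (suc k) (*-monoʳ-≤ 4 (^-monoˡ-≤ c (n≤1+n k))) ⟩
      4 * suc k ^ c * suc k                ≡⟨ *-assoc 4 (suc k ^ c) (suc k) ⟩
      4 * (suc k ^ c * suc k)              ≡⟨ cong (4 *_) (*-comm (suc k ^ c) (suc k)) ⟩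
      4 * suc k ^ suc c                    ≡⟨ cong (λ e → 4 * suc k ^ e) (+-comm 1 c) ⟩
      4 * suc k ^ (c + 1)                  ≡⟨ cong (λ e → 4 * suc k ^ (c + e)) (primeCandidate-prime pk) ⟨
      4 * suc k ^ candidatesBelow (suc k) ∎
  }
  where
  open NonSquareClass C
  open ≤-Reasoning
  k = 3 + j
  c = candidatesBelow k
  r = proj₁ (∃-nonSquareMod j)
  instance _ = prime⇒nonZero pk
  k∤L : ¬ k ∣ L
  k∤L k∣L = [ (λ ()) , <-irrefl refl ]′ (prime∣L pk k∣L)
  solution = solve-n+L*t≡r pk k∤L n r
  t = proj₁ solution
  t<k = proj₁ (proj₂ solution)
  prime∣L′ : ∀ {p} → Prime p → p ∣ L * k → p ≡ 2 ⊎ p < suc k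
  prime∣L′ {p} pp p∣Lk with euclidsLemma L k pp p∣Lk
  ... | inj₁ p∣L = map₂ m<n⇒m<1+n (prime∣L pp p∣L)
  ... | inj₂ p∣k with prime⇒irreducible pk p∣k
  ...   | inj₁ refl = contradiction pp ¬prime[1]
  ...   | inj₂ refl = inj₂ ≤-refl
  oddPrime∣L′ : ∀ {p} → Prime p → p ≢ 2 → p < suc k → p ∣ L * k
  oddPrime∣L′ pp p≢2 p<1+k with m<1+n⇒m<n∨m≡n p<1+k
  ... | inj₁ p<k  = ∣-trans (oddPrime∣L pp p≢2 p<k) (m∣m*n k)
  ... | inj₂ refl = n∣m*n L
  nonSquare′ : ∀ {p} .{{_ : NonZero p}} → Prime p → p ≢ 2 → p < suc k → NonSquareMod p (n + L * t)
  nonSquare′ pp p≢2 p<1+k with m<1+n⇒m<n∨m≡n p<1+k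
  ... | inj₁ p<k  = member-nonSquare C t pp p≢2 p<k
  ... | inj₂ refl = NonSquareMod-cong {n = r} {n + L * t} (sym (proj₂ (proj₂ solution))) (proj₂ (∃-nonSquareMod j))

nextClass : ∀ k → NonSquareClass k → NonSquareClass (suc k)
nextClass 0 = skip-nonOddPrime (λ p0 _ → ¬prime[0] p0)
nextClass 1 = skip-nonOddPrime (λ p1 _ → ¬prime[1] p1)
nextClass 2 = skip-nonOddPrime (λ _ 2≢2 → 2≢2 refl)
nextClass (suc (suc (suc j))) with prime? (3 + j)
... | yes pk = extend-oddPrime j pk
... | no ¬pk = skip-nonOddPrime (λ pk _ → ¬pk pk)

nonSquareClass : ∀ k → NonSquareClass k
nonSquareClass zero    = nonSquareClass₀
nonSquareClass (suc k) = nextClass k (nonSquareClass k)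

member<K^[1+cands] : ∀ {K} (C : NonSquareClass K) t → 4 * suc t ≤ K →
                     NonSquareClass.n C + NonSquareClass.L C * t < K ^ suc (candidatesBelow K)
member<K^[1+cands] {K} C t 4[1+t]≤K = begin-strict
  n + L * t          <⟨ +-monoˡ-< (L * t) n<L ⟩
  L + L * t          ≡⟨ *-suc L t ⟨
  L * suc t          ≤⟨ *-monoˡ-≤ (suc t) L≤4*k^cands ⟩
  4 * K ^ c * suc t  ≡⟨ regroup 4 (K ^ c) (suc t) ⟩
  K ^ c * (4 * suc t) ≤⟨ *-monoʳ-≤ (K ^ c) 4[1+t]≤K ⟩
  K ^ c * K          ≡⟨ *-comm (K ^ c) K ⟩
  K ^ suc c          ∎
  where
  open NonSquareClass C
  open ≤-Reasoning
  c = candidatesBelow K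
  regroup : ∀ a b d → a * b * d ≡ b * (a * d)
  regroup = solve-∀

-- Sums of a Zumkeller number and a square

square%4≢2 : ∀ x → (x * x) % 4 ≢ 2
square%4≢2 x x²%4≡2 = residue (x % 4) (m%n<n x 4) (trans (sym (%-distribˡ-* x x 4)) x²%4≡2)
  where
  residue : ∀ r → r < 4 → (r * r) % 4 ≢ 2
  residue 0 _ ()
  residue 1 _ ()
  residue 2 _ ()
  residue 3 _ ()
  residue (suc (suc (suc (suc _)))) (s≤s (s≤s (s≤s (s≤s ())))) _

module _ {K N c : ℕ} (N%4≡2 : N % 4 ≡ 2)
         (nonSquare : ∀ {p} .{{_ : NonZero p}} → Prime p → p ≢ 2 → p < K → NonSquareMod p N)
         (N<K^[1+c] : N < K ^ suc c) (4c<K : 4 * c < K) where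

  oddPrime∣z⇒K≤p : ∀ {z x p} → N ≡ z + x * x → Prime p → p ≢ 2 → p ∣ z → K ≤ p
  oddPrime∣z⇒K≤p {z} {x} {p} N≡z+x² pp p≢2 p∣z = ≮⇒≥ λ p<K →
    nonSquare pp p≢2 p<K x (sym (trans (cong (_% p) N≡z+x²) (%-remove-+ˡ (x * x) p∣z)))
    where instance _ = prime⇒nonZero pp

  odd∣z⇒3*σ[m]<4*m : ∀ {z x m} → N ≡ z + x * x → 1 ≤ z → ¬ 2 ∣ m → m ∣ z → 3 * σ m < 4 * m
  odd∣z⇒3*σ[m]<4*m {z} {x} {zero}      _        _   m-odd _   = contradiction (2 ∣0) m-odd
  odd∣z⇒3*σ[m]<4*m {z} {x} {m@(suc _)} N≡z+x² 1≤z m-odd m∣z =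
    subst (λ m → 3 * σ m < 4 * m) (sym m≡Πps)
      (σ-product-of-large-primes K ps pps (All.tabulate K≤p) 4j<1+K)
    where
    instance
      _ = >-nonZero 1≤z
      _ = >-nonZero (≤-<-trans z≤n 4c<K)
    factorisation = factorise m
    ps = PrimeFactorisation.factors factorisation
    m≡Πps = PrimeFactorisation.isFactorisation factorisation
    pps = PrimeFactorisation.factorsPrime factorisation
    K≤p : ∀ {p} → p ∈ ps → K ≤ p
    K≤p p∈ps = oddPrime∣z⇒K≤p {z} {x} N≡z+x² (All.lookup pps p∈ps) (λ { refl → m-odd p∣m }) (∣-trans p∣m m∣z)
      where p∣m = subst (_ ∣_) (sym m≡Πps) (∈⇒∣product p∈ps)
    j≤c : length ps ≤ c
    j≤c = ≮⇒≥ λ c<j → <⇒≱ N<K^[1+c] (begin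
      K ^ suc c         ≤⟨ ^-monoʳ-≤ K c<j ⟩
      K ^ length ps     ≤⟨ ^length≤product ps (All.tabulate K≤p) ⟩
      product ps        ≡⟨ m≡Πps ⟨
      m                 ≤⟨ ∣⇒≤ m∣z ⟩
      z                 ≤⟨ m≤m+n z (x * x) ⟩
      z + x * x         ≡⟨ N≡z+x² ⟨
      N                 ∎)
      where open ≤-Reasoning
    4j<1+K : 4 * length ps < 1 + K
    4j<1+K = ≤-<-trans (*-monoʳ-≤ 4 j≤c) (m<n⇒m<1+n 4c<K)

  N≡2m+x²⇒m-odd : ∀ {m x} → N ≡ m * 2 + x * x → ¬ 2 ∣ m
  N≡2m+x²⇒m-odd {m} {x} N≡2m+x² (divides q refl) = square%4≢2 x (begin
    (x * x) % 4             ≡⟨ %-remove-+ˡ (x * x) (divides q (*-assoc q 2 2)) ⟨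
    (q * 2 * 2 + x * x) % 4 ≡⟨ cong (_% 4) N≡2m+x² ⟨
    N % 4                   ≡⟨ N%4≡2 ⟩
    2                       ∎)
    where open ≡-Reasoning

  ¬zumkeller+square : ∀ {z x} → Zumkeller z → N ≡ z + x * x → ⊥
  ¬zumkeller+square {z} {x} zz@(1≤z , _) N≡z+x² with 2 ∣? z
  ... | no z-odd = <-irrefl refl (begin-strict
    3 * (2 * z) ≤⟨ *-monoʳ-≤ 3 (zumkeller⇒abundant zz) ⟩
    3 * σ z     <⟨ odd∣z⇒3*σ[m]<4*m {z} {x} N≡z+x² 1≤z z-odd ∣-refl ⟩
    4 * z       ≤⟨ *-monoˡ-≤ z (≤ᵇ⇒≤ 4 6 _) ⟩
    6 * z       ≡⟨ *-assoc 3 2 z ⟩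
    3 * (2 * z) ∎)
    where open ≤-Reasoning
  ... | yes (divides m refl) = <-irrefl refl (begin-strict
    4 * m       ≡⟨ *-assoc 2 2 m ⟩
    2 * (2 * m) ≡⟨ cong (2 *_) (*-comm 2 m) ⟩
    2 * z       ≤⟨ zumkeller⇒abundant zz ⟩
    σ (m * 2)   ≡⟨ cong σ (*-comm m 2) ⟩
    σ (2 * m)   ≤⟨ σ[p*n]≤[1+p]*σ[n] {n = m} prime[2] ⟩
    3 * σ m     <⟨ odd∣z⇒3*σ[m]<4*m {z} {x} N≡z+x² 1≤z m-odd (m∣m*n 2) ⟩
    4 * m       ∎)
    where
    open ≤-Reasoning
    m-odd = N≡2m+x²⇒m-odd {m} {x} N≡z+x²
    instance _ = m*n≢0⇒m≢0 m {{>-nonZero 1≤z}}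

4*candidatesBelow[K]<K : ∀ t → 4 * candidatesBelow (210 * (2 + t)) < 210 * (2 + t)
4*candidatesBelow[K]<K t = begin-strict
  4 * candidatesBelow (210 * (2 + t)) ≡⟨ cong (4 *_) (candidatesBelow-210 (suc t)) ⟩
  4 * (55 + 48 * suc t)               <⟨ m≤m+n _ (7 + 18 * t) ⟩
  suc (4 * (55 + 48 * suc t)) + (7 + 18 * t) ≡⟨ expand t ⟩
  210 * (2 + t)                       ∎
  where
  open ≤-Reasoning
  expand : ∀ t → suc (4 * (55 + 48 * suc t)) + (7 + 18 * t) ≡ 210 * (2 + t)
  expand = solve-∀

theorem4p17 : ∀ (m : ℕ) → ∃ λ n → m ≤ n × ¬ ZumkellerPlusSquare n
theorem4p17 m = N , m≤N , λ (z , x , zumkeller , _ , N≡z+x^2) →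
  ¬zumkeller+square {K} {N} {candidatesBelow K} (member%4≡2 C m) (member-nonSquare C m)
    (member<K^[1+cands] C m 4[1+m]≤K) (4*candidatesBelow[K]<K m)
    {z} {x} zumkeller (trans N≡z+x^2 (cong (λ y → z + x * y) (*-identityʳ x)))
  where
  K = 210 * (2 + m)
  C = nonSquareClass K
  open NonSquareClass C
  N = n + L * m
  m≤N : m ≤ N
  m≤N = ≤-trans (m≤n*m m L {{>-nonZero (≤-<-trans z≤n n<L)}}) (m≤n+m (L * m) n)
  4[1+m]≤K : 4 * suc m ≤ K
  4[1+m]≤K = *-mono-≤ (≤ᵇ⇒≤ 4 210 _) (n≤1+n (suc m))
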